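{- Let $H$ be a graph and $X$ a graph with at least one vertex. Then $H\circ X$ is a König–Egerváry graph with a perfect matching if and only if $X$ is a König–Egerváry graph with an almost perfect matching. Moreover, $H\circ X$ is a König–Egerváry graph with a unique perfect matching if and only if $X$ is a König–Egerváry graph with a unique almost perfect matching.
   Context: All graphs are finite, simple and undirected. A graph $G$ is König–Egerváry if $\alpha(G)+\mu(G)=n(G)$, where $\alpha$ is the independence number, $\mu$ the maximum matching size and $n(G)$ the number of vertices. A perfect matching saturates all vertices; an almost perfect matching leaves exactly one vertex unsaturated. The corona $H\circ X$ is obtained from $H$ by taking, for each vertex $v$ of $H$, a disjoint copy of $X$ and joining $v$ to all vertices of that copy. -}

module Defs where

open import Data.Nat using (ℕ; _+_; _*_; _≤_; _<_; suc)
open import Data.Fin using (Fin; splitAt; remQuot; _≟_)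
import Data.Fin as F
open import Data.Fin.Subset using (Subset; _∈_; ∣_∣)
open import Data.Bool using (Bool; true; false; _∧_; _∨_)
open import Data.Maybe using (Maybe; just; nothing)
open import Data.Product using (Σ; _×_; _,_; proj₁; proj₂)
open import Data.Sum using (_⊎_; inj₁; inj₂)
open import Data.List using (List; filter; length)
open import Relation.Nullary using (¬_; Dec; yes; no)
open import Relation.Nullary.Decidable using (⌊_⌋)
open import Relation.Binary.PropositionalEquality using (_≡_; _≢_)
import Data.List as L
import Data.Bool as B
open import Relation.Binary.PropositionalEquality using (refl; cong; cong₂)
open import Data.Bool.Properties using (∧-comm; ∧-zeroʳ)
import Data.Fin.Properties as FP

record Graph : Set where
  field
    n     : ℕ
    adj   : Fin n → Fin n → Bool
    sym   : ∀ u v → adj u v ≡ adj v u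
    irrefl : ∀ v → adj v v ≡ false
open Graph public

Adj : (G : Graph) → Fin (n G) → Fin (n G) → Set
Adj G u v = adj G u v ≡ true

Independent : (G : Graph) → Subset (n G) → Set
Independent G S = ∀ u v → u ∈ S → v ∈ S → ¬ Adj G u v

IsIndependenceNumber : (G : Graph) → ℕ → Set
IsIndependenceNumber G k =
  (Σ (Subset (n G)) λ S → Independent G S × ∣ S ∣ ≡ k)
  × (∀ S → Independent G S → ∣ S ∣ ≤ k)

record Matching (G : Graph) : Set where
  field
    mate      : Fin (n G) → Maybe (Fin (n G))
    mate-adj  : ∀ u v → mate u ≡ just v → Adj G u v
    mate-symm : ∀ u v → mate u ≡ just v → mate v ≡ just u
open Matching public

-- number of edges of a matching = number of vertices u matched to some v with u < v
smaller-end : {G : Graph} → Matching G → Fin (n G) → Bool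
smaller-end M u with mate M u
... | nothing = false
... | just v  = ⌊ u F.<? v ⌋

size : {G : Graph} → Matching G → ℕ
size {G} M = length (L.filter (λ u → smaller-end M u B.≟ true) (L.allFin (n G)))

IsMatchingNumber : (G : Graph) → ℕ → Set
IsMatchingNumber G k =
  (Σ (Matching G) λ M → size M ≡ k) × (∀ (M : Matching G) → size M ≤ k)

KE : Graph → Set
KE G = Σ ℕ λ a → Σ ℕ λ m →
  IsIndependenceNumber G a × IsMatchingNumber G m × a + m ≡ n G

Saturated : {G : Graph} → Matching G → Fin (n G) → Set
Saturated M u = Σ _ λ v → mate M u ≡ just v

Perfect : {G : Graph} → Matching G → Set
Perfect {G} M = ∀ u → Saturated M u

AlmostPerfect : {G : Graph} → Matching G → Set
AlmostPerfect {G} M = Σ (Fin (n G)) λ w →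
  (mate M w ≡ nothing) × (∀ u → u ≢ w → Saturated M u)

SameMatching : {G : Graph} → Matching G → Matching G → Set
SameMatching {G} M N = ∀ u → mate M u ≡ mate N u

HasPerfectMatching : Graph → Set
HasPerfectMatching G = Σ (Matching G) Perfect

HasUniquePerfectMatching : Graph → Set
HasUniquePerfectMatching G = Σ (Matching G) λ M → Perfect M ×
  (∀ N → Perfect N → SameMatching M N)

HasAlmostPerfectMatching : Graph → Set
HasAlmostPerfectMatching G = Σ (Matching G) AlmostPerfect

HasUniqueAlmostPerfectMatching : Graph → Set
HasUniqueAlmostPerfectMatching G = Σ (Matching G) λ M → AlmostPerfect M ×
  (∀ N → AlmostPerfect N → SameMatching M N)

-- Corona H ∘ X: vertices Fin (h + h * x); the first h are the vertices of H,
-- the block remQuot-indexed by (v , a) is the copy of vertex a of X attached to v.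
CVert : ℕ → ℕ → Set
CVert h x = Fin h ⊎ (Fin h × Fin x)

decode : (h x : ℕ) → Fin (h + h * x) → CVert h x
decode h x i with splitAt h i
... | inj₁ v = inj₁ v
... | inj₂ j = inj₂ (remQuot {h} x j)

coronaAdj' : (H X : Graph) → CVert (n H) (n X) → CVert (n H) (n X) → Bool
coronaAdj' H X (inj₁ v) (inj₁ w) = adj H v w
coronaAdj' H X (inj₁ v) (inj₂ (w , a)) = ⌊ v ≟ w ⌋
coronaAdj' H X (inj₂ (v , a)) (inj₁ w) = ⌊ v ≟ w ⌋
coronaAdj' H X (inj₂ (v , a)) (inj₂ (w , b)) = ⌊ v ≟ w ⌋ ∧ adj X a b

≟-sym : ∀ {k} (v w : Fin k) → ⌊ v ≟ w ⌋ ≡ ⌊ w ≟ v ⌋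
≟-sym v w with v ≟ w | w ≟ v
... | yes _ | yes _ = refl
... | no _  | no _  = refl
... | yes p | no q  = Data.Empty.⊥-elim (q (Relation.Binary.PropositionalEquality.sym p))
  where import Data.Empty
... | no q  | yes p = Data.Empty.⊥-elim (q (Relation.Binary.PropositionalEquality.sym p))
  where import Data.Empty

coronaAdj'-sym : (H X : Graph) → ∀ u v → coronaAdj' H X u v ≡ coronaAdj' H X v u
coronaAdj'-sym H X (inj₁ v) (inj₁ w) = sym H v w
coronaAdj'-sym H X (inj₁ v) (inj₂ (w , a)) = ≟-sym v w
coronaAdj'-sym H X (inj₂ (v , a)) (inj₁ w) = ≟-sym v w
coronaAdj'-sym H X (inj₂ (v , a)) (inj₂ (w , b)) = cong₂ _∧_ (≟-sym v w) (sym X a b)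

coronaAdj'-irr : (H X : Graph) → ∀ u → coronaAdj' H X u u ≡ false
coronaAdj'-irr H X (inj₁ v) = irrefl H v
coronaAdj'-irr H X (inj₂ (v , a)) rewrite irrefl X a = ∧-zeroʳ ⌊ v ≟ v ⌋

_∘ᶜ_ : Graph → Graph → Graph
H ∘ᶜ X = record
  { n = n H + n H * n X
  ; adj = λ i j → coronaAdj' H X (decode (n H) (n X) i) (decode (n H) (n X) j)
  ; sym = λ i j → coronaAdj'-sym H X (decode (n H) (n X) i) (decode (n H) (n X) j)
  ; irrefl = λ i → coronaAdj'-irr H X (decode (n H) (n X) i)
  }

{-# OPTIONS --safe #-}
-- For a matching M and an independent set S of a graph on n vertices, |S| + |M| ≤ n: charge
-- each vertex of S to itself if it is M-exposed and otherwise to the smaller end of its M-edge;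
-- no vertex is charged twice. Equality holds iff S contains every exposed vertex and an end of
-- every M-edge, so a graph is König–Egerváry iff some, equivalently every, maximum matching has
-- such a partner S; perfect and almost perfect matchings are maximum.
--
-- In H ∘ X take a perfect matching with such an S. Two vertices of H are never matched to each
-- other: one of them, say v, lies in S, so no vertex of v's copy of X does, yet the vertices of
-- that copy are then matched inside the copy, by edges missing S. Hence each v is matched to a
-- vertex a of its own copy, the matching restricts to an almost perfect matching of the copy
-- exposing a, and {a} together with the trace of S on the copy witnesses that X is
-- König–Egerváry. Conversely an almost perfect matching of X exposing w, with its witness S,
-- gives the perfect matching of H ∘ X pairing every v with its copy of w, witnessed by the
-- copies of S. Restriction and this lifting are mutually inverse, which transfers uniqueness.

module Submission where

open import Defs hiding (sym)

import Data.Nat.Properties as ℕₚ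
open import Algebra.Properties.CommutativeMonoid.Sum ℕₚ.+-0-commutativeMonoid
  using (sum; sum-cong-≗; sum-permute; sum-replicate-zero; ∑-distrib-+)
open import Data.Bool using (Bool; true; false)
import Data.Bool as Bool
open import Data.Bool.Properties using (¬-not)
open import Data.Empty using (⊥; ⊥-elim)
open import Data.Fin using (Fin; zero; suc; _<?_; _≟_; _↑ˡ_; _↑ʳ_; combine; splitAt; fromℕ<)
import Data.Fin.Properties as Finₚ
open import Data.Fin.Permutation using (permutation)
open import Data.Fin.Subset using (Subset; _∈_; ∣_∣; ⁅_⁆; _∪_)
open import Data.Fin.Subset.Properties
  using (x∈⁅x⁆; x∈⁅y⁆⇒x≡y; x≢y⇒x∉⁅y⁆; ∣⁅x⁆∣≡1; x∈p∪q⁺; x∈p∪q⁻)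
open import Data.List using (filter; length; tabulate)
open import Data.Maybe using (Maybe; just; nothing; is-nothing; fromMaybe)
open import Data.Maybe.Properties using (just-injective)
open import Data.Nat using (ℕ; zero; suc; _+_; _*_; _≤_; _≥_; z≤n; s≤s)
open import Data.Product using (Σ; _×_; _,_; proj₁; proj₂)
open import Data.Sum using (_⊎_; inj₁; inj₂)
import Data.Sum as Sum
open import Data.Vec using ([]; _∷_; lookup)
import Data.Vec as Vec
import Data.Vec.Properties as Vecₚ
open import Function.Base using (_∘_; id)
open import Function.Bundles using (_⇔_; mk⇔)
open import Relation.Binary.Definitions using (tri<; tri≈; tri>)
open import Relation.Binary.PropositionalEquality
open import Relation.Nullary using (yes; no; contradiction)
open import Relation.Nullary.Decidable using (⌊_⌋)

𝟙 : Bool → ℕ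
𝟙 true  = 1
𝟙 false = 0

𝟙≤1 : ∀ b → 𝟙 b ≤ 1
𝟙≤1 true  = s≤s z≤n
𝟙≤1 false = z≤n

𝟙*-≤ : ∀ b {x} → (b ≡ true → x ≤ 1) → 𝟙 b * x ≤ 𝟙 b
𝟙*-≤ true  x≤1 = ℕₚ.≤-trans (ℕₚ.≤-reflexive (ℕₚ.+-identityʳ _)) (x≤1 refl)
𝟙*-≤ false _   = z≤n

𝟙*-≡ : ∀ b {x} → (b ≡ true → x ≡ 1) → 𝟙 b * x ≡ 𝟙 b
𝟙*-≡ true  x≡1 = trans (ℕₚ.+-identityʳ _) (x≡1 refl)
𝟙*-≡ false _   = refl

𝟙*-≡⁻ : ∀ b {x} → 𝟙 b * x ≡ 𝟙 b → b ≡ true → x ≡ 1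
𝟙*-≡⁻ true eq refl = trans (sym (ℕₚ.+-identityʳ _)) eq

𝟙≡1⇒true : ∀ {b} → 𝟙 b ≡ 1 → b ≡ true
𝟙≡1⇒true {true} _ = refl

𝟙+𝟙≤1 : ∀ a c → (a ≡ true → c ≡ true → ⊥) → 𝟙 a + 𝟙 c ≤ 1
𝟙+𝟙≤1 true  true  ¬both = contradiction refl (¬both refl)
𝟙+𝟙≤1 true  false _     = s≤s z≤n
𝟙+𝟙≤1 false c     _     = 𝟙≤1 c

𝟙+𝟙≡1 : ∀ a c → (a ≡ true → c ≡ true → ⊥) → a ≡ true ⊎ c ≡ true → 𝟙 a + 𝟙 c ≡ 1
𝟙+𝟙≡1 true  true  ¬both _          = contradiction refl (¬both refl)
𝟙+𝟙≡1 true  false _     _          = refl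
𝟙+𝟙≡1 false true  _     _          = refl
𝟙+𝟙≡1 false false _     (inj₁ ())
𝟙+𝟙≡1 false false _     (inj₂ ())

𝟙+𝟙≡1⁻ : ∀ a c → 𝟙 a + 𝟙 c ≡ 1 → a ≡ true ⊎ c ≡ true
𝟙+𝟙≡1⁻ true  _     _  = inj₁ refl
𝟙+𝟙≡1⁻ false true  _  = inj₂ refl

≤→≤→+≡+⇒≡×≡ : ∀ {a b c d} → a ≤ b → c ≤ d → a + c ≡ b + d → a ≡ b × c ≡ d
≤→≤→+≡+⇒≡×≡ {a} {b} {c} {d} a≤b c≤d eq =
  a≡b , ℕₚ.+-cancelˡ-≡ b c d (trans (cong (_+ c) (sym a≡b)) eq)
  where
  open ℕₚ.≤-Reasoning
  a≡b : a ≡ b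
  a≡b = ℕₚ.≤-antisym a≤b (ℕₚ.+-cancelʳ-≤ d b a (begin
    b + d ≡⟨ sym eq ⟩
    a + c ≤⟨ ℕₚ.+-monoʳ-≤ a c≤d ⟩
    a + d ∎))

m+m≤1+n+n⇒m≤n : ∀ m n → m + m ≤ suc (n + n) → m ≤ n
m+m≤1+n+n⇒m≤n zero          n       _        = z≤n
m+m≤1+n+n⇒m≤n (suc zero)    zero    (s≤s ())
m+m≤1+n+n⇒m≤n (suc (suc m)) zero    (s≤s ())
m+m≤1+n+n⇒m≤n (suc m)       (suc n) (s≤s le) = s≤s (m+m≤1+n+n⇒m≤n m n
  (ℕₚ.≤-pred (subst₂ _≤_ (ℕₚ.+-suc m m) (cong suc (ℕₚ.+-suc n n)) le)))

sum-mono-≤ : ∀ {k} {f g : Fin k → ℕ} → (∀ i → f i ≤ g i) → sum f ≤ sum g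
sum-mono-≤ {zero}  _   = z≤n
sum-mono-≤ {suc k} f≤g = ℕₚ.+-mono-≤ (f≤g zero) (sum-mono-≤ (f≤g ∘ suc))

sum-≡⇒≗ : ∀ {k} {f g : Fin k → ℕ} → (∀ i → f i ≤ g i) → sum f ≡ sum g → ∀ i → f i ≡ g i
sum-≡⇒≗ f≤g eq zero    = proj₁ (≤→≤→+≡+⇒≡×≡ (f≤g zero) (sum-mono-≤ (f≤g ∘ suc)) eq)
sum-≡⇒≗ f≤g eq (suc i) =
  sum-≡⇒≗ (f≤g ∘ suc) (proj₂ (≤→≤→+≡+⇒≡×≡ (f≤g zero) (sum-mono-≤ (f≤g ∘ suc)) eq)) i

sum-1≡k : ∀ k → sum {k} (λ _ → 1) ≡ k
sum-1≡k zero    = refl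
sum-1≡k (suc k) = cong suc (sum-1≡k k)

∣S∣≡sum : ∀ {k} (S : Subset k) → ∣ S ∣ ≡ sum (𝟙 ∘ lookup S)
∣S∣≡sum []          = refl
∣S∣≡sum (true ∷ S)  = cong suc (∣S∣≡sum S)
∣S∣≡sum (false ∷ S) = ∣S∣≡sum S

length-filter-tabulate : ∀ {A : Set} {k} (f : Fin k → A) (p : A → Bool) →
  length (filter (λ a → p a Bool.≟ true) (tabulate f)) ≡ sum (𝟙 ∘ p ∘ f)
length-filter-tabulate {k = zero}  f p = refl
length-filter-tabulate {k = suc k} f p with p (f zero)
... | true  = cong suc (length-filter-tabulate (f ∘ suc) p)
... | false = length-filter-tabulate (f ∘ suc) p

lookup⇒∈ : ∀ {k} {S : Subset k} {u} → lookup S u ≡ true → u ∈ S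
lookup⇒∈ {S = S} {u} = Vecₚ.lookup⇒[]= u S

∈⇒lookup : ∀ {k} {S : Subset k} {u} → u ∈ S → lookup S u ≡ true
∈⇒lookup = Vecₚ.[]=⇒lookup

∈-tabulate⁺ : ∀ {k} {f : Fin k → Bool} {i} → f i ≡ true → i ∈ Vec.tabulate f
∈-tabulate⁺ {f = f} {i} fi = lookup⇒∈ (trans (Vecₚ.lookup∘tabulate f i) fi)

∈-tabulate⁻ : ∀ {k} {f : Fin k → Bool} {i} → i ∈ Vec.tabulate f → f i ≡ true
∈-tabulate⁻ {f = f} {i} i∈ = trans (sym (Vecₚ.lookup∘tabulate f i)) (∈⇒lookup i∈)

<?-trichotomy : ∀ {k} {u v : Fin k} → u ≢ v → 𝟙 ⌊ u <? v ⌋ + 𝟙 ⌊ v <? u ⌋ ≡ 1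
<?-trichotomy {u = u} {v} u≢v with u <? v | v <? u
... | yes u<v | yes v<u = contradiction v<u (Finₚ.<-asym u<v)
... | yes _   | no _    = refl
... | no _    | yes _   = refl
... | no u≮v  | no v≮u with Finₚ.<-cmp u v
...   | tri< u<v _   _   = contradiction u<v u≮v
...   | tri≈ _   u≡v _   = contradiction u≡v u≢v
...   | tri> _   _   v<u = contradiction v<u v≮u

Adj⇒≢ : ∀ (G : Graph) {u v} → Adj G u v → u ≢ v
Adj⇒≢ G {u} uv refl with trans (sym (irrefl G u)) uv
... | ()

record KEWitness (G : Graph) (S : Subset (n G)) (M : Matching G) : Set where
  field
    independent : Independent G S
    exposed∈    : ∀ u → mate M u ≡ nothing → u ∈ S
    edge-meets  : ∀ u v → mate M u ≡ just v → u ∈ S ⊎ v ∈ S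

module _ {G : Graph} (M : Matching G) where

  exposed : Fin (n G) → Bool
  exposed u = is-nothing (mate M u)

  partner : Fin (n G) → Fin (n G)
  partner u = fromMaybe u (mate M u)

  partner-involutive : ∀ u → partner (partner u) ≡ u
  partner-involutive u with mate M u in eq
  ... | nothing = cong (fromMaybe u) eq
  ... | just v  = cong (fromMaybe v) (mate-symm M u v eq)

  exposed+lower+upper≡1 : ∀ u →
    𝟙 (exposed u) + 𝟙 (smaller-end M u) + 𝟙 (smaller-end M (partner u)) ≡ 1
  exposed+lower+upper≡1 u with mate M u in eq
  ... | nothing rewrite eq = refl
  ... | just v  rewrite mate-symm M u v eq = <?-trichotomy (Adj⇒≢ G (mate-adj M u v eq))

  sum-by-matching : ∀ (f : Fin (n G) → ℕ) → sum f ≡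
    sum (λ u → 𝟙 (exposed u) * f u + 𝟙 (smaller-end M u) * (f u + f (partner u)))
  sum-by-matching f = begin
    sum f                                             ≡⟨ sum-cong-≗ split ⟩
    sum (λ u → atSelf u + atUpper u)                  ≡⟨ ∑-distrib-+ atSelf atUpper ⟩
    sum atSelf + sum atUpper                          ≡⟨ cong (sum atSelf +_) reindex ⟩
    sum atSelf + sum atPartner                        ≡⟨ ∑-distrib-+ atSelf atPartner ⟨
    sum (λ u → atSelf u + atPartner u)                ≡⟨ sum-cong-≗ regroup ⟩
    sum (λ u → 𝟙 (exposed u) * f u + 𝟙 (lower u) * (f u + f (partner u))) ∎
    where
    open ≡-Reasoning
    lower upper : Fin (n G) → Bool
    lower = smaller-end M
    upper = smaller-end M ∘ partner
    atSelf atUpper atPartner : Fin (n G) → ℕ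
    atSelf    u = 𝟙 (exposed u) * f u + 𝟙 (lower u) * f u
    atUpper   u = 𝟙 (upper u) * f u
    atPartner u = 𝟙 (lower u) * f (partner u)
    split : ∀ u → f u ≡ atSelf u + atUpper u
    split u = sym (begin
      𝟙 (exposed u) * f u + 𝟙 (lower u) * f u + 𝟙 (upper u) * f u
        ≡⟨ cong (_+ atUpper u) (ℕₚ.*-distribʳ-+ (f u) (𝟙 (exposed u)) (𝟙 (lower u))) ⟨
      (𝟙 (exposed u) + 𝟙 (lower u)) * f u + 𝟙 (upper u) * f u
        ≡⟨ ℕₚ.*-distribʳ-+ (f u) (𝟙 (exposed u) + 𝟙 (lower u)) (𝟙 (upper u)) ⟨
      (𝟙 (exposed u) + 𝟙 (lower u) + 𝟙 (upper u)) * f u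
        ≡⟨ cong (_* f u) (exposed+lower+upper≡1 u) ⟩
      1 * f u
        ≡⟨ ℕₚ.*-identityˡ (f u) ⟩
      f u ∎)
    reindex : sum atUpper ≡ sum atPartner
    reindex = trans
      (sum-permute atUpper (permutation partner partner partner-involutive partner-involutive))
      (sum-cong-≗ (λ u → cong (λ v → 𝟙 (lower v) * f (partner u)) (partner-involutive u)))
    regroup : ∀ u → atSelf u + atPartner u ≡ 𝟙 (exposed u) * f u + 𝟙 (lower u) * (f u + f (partner u))
    regroup u = trans (ℕₚ.+-assoc (𝟙 (exposed u) * f u) _ _)
      (cong (𝟙 (exposed u) * f u +_) (sym (ℕₚ.*-distribˡ-+ (𝟙 (lower u)) (f u) (f (partner u)))))

  #exposed : ℕ
  #exposed = sum (𝟙 ∘ exposed)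

  size≡sum : size M ≡ sum (𝟙 ∘ smaller-end M)
  size≡sum = length-filter-tabulate (λ u → u) (smaller-end M)

  n≡#exposed+size+size : n G ≡ #exposed + size M + size M
  n≡#exposed+size+size = begin
    n G
      ≡⟨ sym (sum-1≡k (n G)) ⟩
    sum {n G} (λ _ → 1)
      ≡⟨ sum-by-matching (λ _ → 1) ⟩
    sum (λ u → 𝟙 (exposed u) * 1 + 𝟙 (smaller-end M u) * 2)
      ≡⟨ sum-cong-≗ (λ u → weights (exposed u) (smaller-end M u)) ⟩
    sum (λ u → 𝟙 (exposed u) + 𝟙 (smaller-end M u) + 𝟙 (smaller-end M u))
      ≡⟨ trans (∑-distrib-+ (λ u → 𝟙 (exposed u) + 𝟙 (smaller-end M u)) (𝟙 ∘ smaller-end M))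
               (cong (_+ sum (𝟙 ∘ smaller-end M)) (∑-distrib-+ (𝟙 ∘ exposed) (𝟙 ∘ smaller-end M))) ⟩
    #exposed + sum (𝟙 ∘ smaller-end M) + sum (𝟙 ∘ smaller-end M)
      ≡⟨ cong (λ m → #exposed + m + m) (sym size≡sum) ⟩
    #exposed + size M + size M ∎
    where
    open ≡-Reasoning
    weights : ∀ a b → 𝟙 a * 1 + 𝟙 b * 2 ≡ 𝟙 a + 𝟙 b + 𝟙 b
    weights true  true  = refl
    weights true  false = refl
    weights false true  = refl
    weights false false = refl

  capacity : Fin (n G) → ℕ
  capacity u = 𝟙 (exposed u) + 𝟙 (smaller-end M u)

  load : Subset (n G) → Fin (n G) → ℕ
  load S u = 𝟙 (exposed u) * 𝟙 (lookup S u)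
           + 𝟙 (smaller-end M u) * (𝟙 (lookup S u) + 𝟙 (lookup S (partner u)))

  sum-capacity+size≡n : sum capacity + size M ≡ n G
  sum-capacity+size≡n = begin
    sum capacity + size M
      ≡⟨ cong (_+ size M) (∑-distrib-+ (𝟙 ∘ exposed) (𝟙 ∘ smaller-end M)) ⟩
    #exposed + sum (𝟙 ∘ smaller-end M) + size M
      ≡⟨ cong (λ m → #exposed + m + size M) size≡sum ⟨
    #exposed + size M + size M
      ≡⟨ n≡#exposed+size+size ⟨
    n G ∎
    where open ≡-Reasoning

  ∣S∣≡sum-load : ∀ S → ∣ S ∣ ≡ sum (load S)
  ∣S∣≡sum-load S = trans (∣S∣≡sum S) (sum-by-matching (𝟙 ∘ lookup S))

  exposed⇒nothing : ∀ {u} → exposed u ≡ true → mate M u ≡ nothing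
  exposed⇒nothing {u} e with mate M u
  ... | nothing = refl
  exposed⇒nothing () | just _

  smaller-end⇒mate : ∀ {u} → smaller-end M u ≡ true → mate M u ≡ just (partner u)
  smaller-end⇒mate {u} l with mate M u
  ... | just _ = refl
  smaller-end⇒mate () | nothing

  mate⇒lower∨upper : ∀ {u v} → mate M u ≡ just v → smaller-end M u ≡ true ⊎ smaller-end M v ≡ true
  mate⇒lower∨upper {u} eq = 𝟙+𝟙≡1⁻ _ _ (subst₂
    (λ e w → 𝟙 e + 𝟙 (smaller-end M u) + 𝟙 (smaller-end M w) ≡ 1)
    (cong is-nothing eq) (cong (fromMaybe u) eq) (exposed+lower+upper≡1 u))

  module _ {S : Subset (n G)} (I : Independent G S) where

    ¬both∈ : ∀ {u} → smaller-end M u ≡ true →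
             lookup S u ≡ true → lookup S (partner u) ≡ true → ⊥
    ¬both∈ {u} l su sv = I u (partner u) (lookup⇒∈ su) (lookup⇒∈ sv) (mate-adj M u _ (smaller-end⇒mate l))

    load≤capacity : ∀ u → load S u ≤ capacity u
    load≤capacity u = ℕₚ.+-mono-≤
      (𝟙*-≤ (exposed u) (λ _ → 𝟙≤1 (lookup S u)))
      (𝟙*-≤ (smaller-end M u) (λ l → 𝟙+𝟙≤1 _ _ (¬both∈ l)))

    ∣S∣+size≤n : ∣ S ∣ + size M ≤ n G
    ∣S∣+size≤n = begin
      ∣ S ∣ + size M        ≡⟨ cong (_+ size M) (∣S∣≡sum-load S) ⟩
      sum (load S) + size M ≤⟨ ℕₚ.+-monoˡ-≤ (size M) (sum-mono-≤ load≤capacity) ⟩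
      sum capacity + size M ≡⟨ sum-capacity+size≡n ⟩
      n G                   ∎
      where open ℕₚ.≤-Reasoning

    ∣S∣+size≡n⇒KEWitness : ∣ S ∣ + size M ≡ n G → KEWitness G S M
    ∣S∣+size≡n⇒KEWitness eq = record
      { independent = I
      ; exposed∈    = λ u e →
          lookup⇒∈ (𝟙≡1⇒true (𝟙*-≡⁻ (exposed u) (proj₁ (parts u)) (cong is-nothing e)))
      ; edge-meets  = edge-meets
      }
      where
      tight : ∀ u → load S u ≡ capacity u
      tight = sum-≡⇒≗ load≤capacity (ℕₚ.+-cancelʳ-≡ (size M) _ _ (begin
        sum (load S) + size M ≡⟨ cong (_+ size M) (∣S∣≡sum-load S) ⟨
        ∣ S ∣ + size M        ≡⟨ eq ⟩
        n G                   ≡⟨ sum-capacity+size≡n ⟨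
        sum capacity + size M ∎))
        where open ≡-Reasoning
      parts : ∀ u → 𝟙 (exposed u) * 𝟙 (lookup S u) ≡ 𝟙 (exposed u)
                  × 𝟙 (smaller-end M u) * (𝟙 (lookup S u) + 𝟙 (lookup S (partner u))) ≡ 𝟙 (smaller-end M u)
      parts u = ≤→≤→+≡+⇒≡×≡ (𝟙*-≤ (exposed u) (λ _ → 𝟙≤1 (lookup S u)))
                          (𝟙*-≤ (smaller-end M u) (λ l → 𝟙+𝟙≤1 _ _ (¬both∈ l))) (tight u)
      lower-meets : ∀ {u} → smaller-end M u ≡ true → u ∈ S ⊎ partner u ∈ S
      lower-meets {u} l = Sum.map lookup⇒∈ lookup⇒∈
        (𝟙+𝟙≡1⁻ _ _ (𝟙*-≡⁻ (smaller-end M u) (proj₂ (parts u)) l))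
      edge-meets : ∀ u v → mate M u ≡ just v → u ∈ S ⊎ v ∈ S
      edge-meets u v eq with mate⇒lower∨upper eq
      ... | inj₁ l = subst (λ w → u ∈ S ⊎ w ∈ S) (cong (fromMaybe u) eq) (lower-meets l)
      ... | inj₂ l = Sum.swap
        (subst (λ w → v ∈ S ⊎ w ∈ S) (cong (fromMaybe v) (mate-symm M u v eq)) (lower-meets l))

  KEWitness⇒∣S∣+size≡n : ∀ {S} → KEWitness G S M → ∣ S ∣ + size M ≡ n G
  KEWitness⇒∣S∣+size≡n {S} W = begin
    ∣ S ∣ + size M        ≡⟨ cong (_+ size M) (trans (∣S∣≡sum-load S) (sum-cong-≗ tight)) ⟩
    sum capacity + size M ≡⟨ sum-capacity+size≡n ⟩
    n G                   ∎
    where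
    open ≡-Reasoning
    open KEWitness W
    tight : ∀ u → load S u ≡ capacity u
    tight u = cong₂ _+_
      (𝟙*-≡ (exposed u) (λ e → cong 𝟙 (∈⇒lookup (exposed∈ u (exposed⇒nothing e)))))
      (𝟙*-≡ (smaller-end M u) (λ l → 𝟙+𝟙≡1 _ _ (¬both∈ independent l)
        (Sum.map ∈⇒lookup ∈⇒lookup (edge-meets u (partner u) (smaller-end⇒mate l)))))

IsMaximum : {G : Graph} → Matching G → Set
IsMaximum {G} M = ∀ (N : Matching G) → size N ≤ size M

size+size≤n : {G : Graph} (M : Matching G) → size M + size M ≤ n G
size+size≤n M = subst (size M + size M ≤_)
  (trans (sym (ℕₚ.+-assoc (#exposed M) (size M) (size M))) (sym (n≡#exposed+size+size M)))
  (ℕₚ.m≤n+m (size M + size M) (#exposed M))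

Perfect⇒#exposed≡0 : {G : Graph} (M : Matching G) → Perfect M → #exposed M ≡ 0
Perfect⇒#exposed≡0 {G} M perfect = trans (sum-cong-≗ unexposed) (sum-replicate-zero (n G))
  where
  unexposed : ∀ u → 𝟙 (exposed M u) ≡ 0
  unexposed u = cong (𝟙 ∘ is-nothing) (proj₂ (perfect u))

AlmostPerfect⇒#exposed≡1 : {G : Graph} (M : Matching G) → AlmostPerfect M → #exposed M ≡ 1
AlmostPerfect⇒#exposed≡1 {G} M (w , w-exposed , saturated) = begin
  sum (𝟙 ∘ exposed M)     ≡⟨ sum-cong-≗ (cong 𝟙 ∘ exposed≗⁅w⁆) ⟩
  sum (𝟙 ∘ lookup ⁅ w ⁆) ≡⟨ ∣S∣≡sum ⁅ w ⁆ ⟨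
  ∣ ⁅ w ⁆ ∣               ≡⟨ ∣⁅x⁆∣≡1 w ⟩
  1                       ∎
  where
  open ≡-Reasoning
  exposed≗⁅w⁆ : ∀ u → exposed M u ≡ lookup ⁅ w ⁆ u
  exposed≗⁅w⁆ u with u ≟ w
  ... | yes refl = trans (cong is-nothing w-exposed) (sym (∈⇒lookup (x∈⁅x⁆ w)))
  ... | no u≢w   = trans (cong is-nothing (proj₂ (saturated u u≢w)))
                         (sym (¬-not (x≢y⇒x∉⁅y⁆ u≢w ∘ lookup⇒∈)))

n≤1+size+size⇒IsMaximum : {G : Graph} (M : Matching G) → n G ≤ suc (size M + size M) → IsMaximum M
n≤1+size+size⇒IsMaximum M n≤ N = m+m≤1+n+n⇒m≤n (size N) (size M) (ℕₚ.≤-trans (size+size≤n N) n≤)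

Perfect⇒IsMaximum : {G : Graph} (M : Matching G) → Perfect M → IsMaximum M
Perfect⇒IsMaximum {G} M perfect = n≤1+size+size⇒IsMaximum M (begin
  n G                          ≡⟨ n≡#exposed+size+size M ⟩
  #exposed M + size M + size M ≡⟨ cong (λ e → e + size M + size M) (Perfect⇒#exposed≡0 M perfect) ⟩
  size M + size M              ≤⟨ ℕₚ.n≤1+n _ ⟩
  suc (size M + size M)        ∎)
  where open ℕₚ.≤-Reasoning

AlmostPerfect⇒IsMaximum : {G : Graph} (M : Matching G) → AlmostPerfect M → IsMaximum M
AlmostPerfect⇒IsMaximum {G} M almostPerfect = n≤1+size+size⇒IsMaximum M (ℕₚ.≤-reflexive (begin
  n G                          ≡⟨ n≡#exposed+size+size M ⟩
  #exposed M + size M + size M ≡⟨ cong (λ e → e + size M + size M)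
                                       (AlmostPerfect⇒#exposed≡1 M almostPerfect) ⟩
  suc (size M + size M)        ∎))
  where open ≡-Reasoning

KEWitness⇒KE : {G : Graph} {S : Subset (n G)} {M : Matching G} → KEWitness G S M → KE G
KEWitness⇒KE {G} {S} {M} W =
  ∣ S ∣ , size M , ((S , independent , refl) , S-maximum) , ((M , refl) , M-maximum) , tight
  where
  open KEWitness W
  tight : ∣ S ∣ + size M ≡ n G
  tight = KEWitness⇒∣S∣+size≡n M W
  S-maximum : ∀ T → Independent G T → ∣ T ∣ ≤ ∣ S ∣
  S-maximum T T-independent = ℕₚ.+-cancelʳ-≤ (size M) ∣ T ∣ ∣ S ∣
    (subst (∣ T ∣ + size M ≤_) (sym tight) (∣S∣+size≤n M T-independent))
  M-maximum : IsMaximum M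
  M-maximum N = ℕₚ.+-cancelˡ-≤ ∣ S ∣ (size N) (size M)
    (subst (∣ S ∣ + size N ≤_) (sym tight) (∣S∣+size≤n N independent))

KE⇒KEWitness : {G : Graph} {M : Matching G} → KE G → IsMaximum M →
               Σ (Subset (n G)) λ S → KEWitness G S M
KE⇒KEWitness {M = M} (α , μ , ((S , S-independent , ∣S∣≡α) , _) , ((M₀ , size≡μ) , μ-maximum) , α+μ≡n)
             M-maximum =
  S , ∣S∣+size≡n⇒KEWitness M S-independent (trans (cong₂ _+_ ∣S∣≡α size-M≡μ) α+μ≡n)
  where
  size-M≡μ : size M ≡ μ
  size-M≡μ = ℕₚ.≤-antisym (μ-maximum M) (subst (_≤ size M) size≡μ (M-maximum M₀))

KEWitness-resp : {G : Graph} {S : Subset (n G)} {M N : Matching G} →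
                 SameMatching M N → KEWitness G S M → KEWitness G S N
KEWitness-resp M≈N W = record
  { independent = independent
  ; exposed∈    = λ u e → exposed∈ u (trans (M≈N u) e)
  ; edge-meets  = λ u v e → edge-meets u v (trans (M≈N u) e)
  }
  where open KEWitness W

AlmostPerfect-exposed-unique : {G : Graph} (M : Matching G) (apm : AlmostPerfect M) →
                               ∀ {u} → mate M u ≡ nothing → u ≡ proj₁ apm
AlmostPerfect-exposed-unique M (w , _ , saturated) {u} e with u ≟ w
... | yes u≡w = u≡w
... | no u≢w with trans (sym e) (proj₂ (saturated u u≢w))
...   | ()

module Corona (H X : Graph) where

  C : Graph
  C = H ∘ᶜ X

  V : Set
  V = CVert (n H) (n X)

  _~_ : V → V → Set
  c ~ d = coronaAdj' H X c d ≡ true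

  dec : Fin (n C) → V
  dec = decode (n H) (n X)

  enc : V → Fin (n C)
  enc (inj₁ v)       = v ↑ˡ (n H * n X)
  enc (inj₂ (v , a)) = n H ↑ʳ combine v a

  dec∘enc : ∀ c → dec (enc c) ≡ c
  dec∘enc (inj₁ v) rewrite Finₚ.splitAt-↑ˡ (n H) v (n H * n X) = refl
  dec∘enc (inj₂ (v , a))
    rewrite Finₚ.splitAt-↑ʳ (n H) (n H * n X) (combine v a) | Finₚ.remQuot-combine {n H} {n X} v a = refl

  enc∘dec : ∀ i → enc (dec i) ≡ i
  enc∘dec i with splitAt (n H) i | Finₚ.join-splitAt (n H) (n H * n X) i
  ... | inj₁ v | eq = eq
  ... | inj₂ j | eq = trans (cong (n H ↑ʳ_) (Finₚ.combine-remQuot {n H} (n X) j)) eq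

  enc-injective : ∀ {c d} → enc c ≡ enc d → c ≡ d
  enc-injective {c} {d} eq = trans (sym (dec∘enc c)) (trans (cong dec eq) (dec∘enc d))

  position : V → Maybe (Fin (n X))
  position (inj₁ _)       = nothing
  position (inj₂ (_ , a)) = just a

  over : Fin (n H) → Maybe (Fin (n X)) → V
  over v nothing  = inj₁ v
  over v (just a) = inj₂ (v , a)

  position-over : ∀ v m → position (over v m) ≡ m
  position-over v nothing  = refl
  position-over v (just a) = refl

  hub~copy : ∀ v a → inj₁ v ~ inj₂ (v , a)
  hub~copy v a with v ≟ v
  ... | yes _  = refl
  ... | no v≢v = contradiction refl v≢v

  copy~hub : ∀ v a → inj₂ (v , a) ~ inj₁ v
  copy~hub v a = trans (coronaAdj'-sym H X (inj₂ (v , a)) (inj₁ v)) (hub~copy v a)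

  copy~copy : ∀ {v a b} → Adj X a b → inj₂ (v , a) ~ inj₂ (v , b)
  copy~copy {v} ab with v ≟ v
  ... | yes _  = ab
  ... | no v≢v = contradiction refl v≢v

  copy~copy⁻ : ∀ {v u a b} → inj₂ (v , a) ~ inj₂ (u , b) → Adj X a b
  copy~copy⁻ {v} {u} e with v ≟ u
  ... | yes _ = e
  copy~copy⁻ () | no _

  hub~copy⁻ : ∀ {v u a} → inj₁ v ~ inj₂ (u , a) → v ≡ u
  hub~copy⁻ {v} {u} e with v ≟ u
  ... | yes v≡u = v≡u
  hub~copy⁻ () | no _

  copy-neighbour : ∀ {v a} d → inj₂ (v , a) ~ d → d ≡ over v (position d)
  copy-neighbour {v} (inj₁ u) e with v ≟ u
  ... | yes refl = refl
  copy-neighbour (inj₁ u) () | no _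
  copy-neighbour {v} (inj₂ (u , b)) e with v ≟ u
  ... | yes refl = refl
  copy-neighbour (inj₂ _) () | no _

  -- A perfect matching of H ∘ X, stated on CVert rather than on its encoding Fin (n C).
  record Pairing : Set where
    field
      pair            : V → V
      pair-adjacent   : ∀ c → c ~ pair c
      pair-involutive : ∀ c → pair (pair c) ≡ c
  open Pairing

  toMatching : Pairing → Matching C
  toMatching P = record
    { mate      = λ i → just (enc (pair P (dec i)))
    ; mate-adj  = adjacent
    ; mate-symm = symmetric
    }
    where
    adjacent : ∀ i j → just (enc (pair P (dec i))) ≡ just j → dec i ~ dec j
    adjacent i _ refl = subst (dec i ~_) (sym (dec∘enc _)) (pair-adjacent P (dec i))
    symmetric : ∀ i j → just (enc (pair P (dec i))) ≡ just j → just (enc (pair P (dec j))) ≡ just i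
    symmetric i _ refl = cong just (begin
      enc (pair P (dec (enc (pair P (dec i))))) ≡⟨ cong (enc ∘ pair P) (dec∘enc _) ⟩
      enc (pair P (pair P (dec i)))             ≡⟨ cong enc (pair-involutive P (dec i)) ⟩
      enc (dec i)                               ≡⟨ enc∘dec i ⟩
      i                                         ∎)
      where open ≡-Reasoning

  toMatching-perfect : ∀ P → Perfect (toMatching P)
  toMatching-perfect P i = _ , refl

  mate-toMatching : ∀ P c → mate (toMatching P) (enc c) ≡ just (enc (pair P c))
  mate-toMatching P c = cong (λ d → just (enc (pair P d))) (dec∘enc c)

  pair≗⇒SameMatching : ∀ {P R} → (∀ c → pair P c ≡ pair R c) →
                       SameMatching (toMatching P) (toMatching R)
  pair≗⇒SameMatching P≗R i = cong (just ∘ enc) (P≗R (dec i))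

  SameMatching⇒pair≗ : ∀ {P R} → SameMatching (toMatching P) (toMatching R) →
                       ∀ c → pair P c ≡ pair R c
  SameMatching⇒pair≗ {P} {R} P≈R c = enc-injective (just-injective (begin
    just (enc (pair P c))     ≡⟨ mate-toMatching P c ⟨
    mate (toMatching P) (enc c) ≡⟨ P≈R (enc c) ⟩
    mate (toMatching R) (enc c) ≡⟨ mate-toMatching R c ⟩
    just (enc (pair R c))     ∎))
    where open ≡-Reasoning

  pairingOf : (Q : Matching C) → Perfect Q → Pairing
  pairingOf Q perfect = record
    { pair            = partnerOf
    ; pair-adjacent   = λ c →
        subst (_~ partnerOf c) (dec∘enc c) (mate-adj Q (enc c) _ (proj₂ (perfect (enc c))))
    ; pair-involutive = λ c → enc-injective (just-injective (trans
        (sym (mate-enc (partnerOf c))) (mate-symm Q (enc c) _ (mate-enc c))))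
    }
    where
    partnerOf : V → V
    partnerOf c = dec (proj₁ (perfect (enc c)))
    mate-enc : ∀ c → mate Q (enc c) ≡ just (enc (partnerOf c))
    mate-enc c = trans (proj₂ (perfect (enc c))) (cong just (sym (enc∘dec _)))

  toMatching-pairingOf : ∀ Q perfect → SameMatching (toMatching (pairingOf Q perfect)) Q
  toMatching-pairingOf Q perfect i = begin
    just (enc (dec (proj₁ (perfect (enc (dec i)))))) ≡⟨ cong just (enc∘dec _) ⟩
    just (proj₁ (perfect (enc (dec i))))             ≡⟨ proj₂ (perfect (enc (dec i))) ⟨
    mate Q (enc (dec i))                            ≡⟨ cong (mate Q) (enc∘dec i) ⟩
    mate Q i                                        ∎
    where open ≡-Reasoning

  record IndependentTransversal (P : Pairing) (s : V → Bool) : Set where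
    field
      independent : ∀ c d → s c ≡ true → s d ≡ true → c ~ d → ⊥
      meets       : ∀ c → s c ≡ true ⊎ s (pair P c) ≡ true

  IndependentTransversal⇒KEWitness : ∀ {P s} → IndependentTransversal P s →
                                     KEWitness C (Vec.tabulate (s ∘ dec)) (toMatching P)
  IndependentTransversal⇒KEWitness {P} {s} T = record
    { independent = λ i j i∈ j∈ → independent (dec i) (dec j) (∈-tabulate⁻ i∈) (∈-tabulate⁻ j∈)
    ; exposed∈    = λ _ ()
    ; edge-meets  = edge-meets
    }
    where
    open IndependentTransversal T
    edge-meets : ∀ i j → just (enc (pair P (dec i))) ≡ just j →
                 i ∈ Vec.tabulate (s ∘ dec) ⊎ j ∈ Vec.tabulate (s ∘ dec)
    edge-meets i _ refl = Sum.map ∈-tabulate⁺ (∈-tabulate⁺ ∘ subst (λ d → s d ≡ true) (sym (dec∘enc _)))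
                                  (meets (dec i))

  KEWitness⇒IndependentTransversal : ∀ {P S} → KEWitness C S (toMatching P) →
                                     IndependentTransversal P (λ c → lookup S (enc c))
  KEWitness⇒IndependentTransversal {P} {S} W = record
    { independent = λ c d c∈ d∈ c~d → independent (enc c) (enc d) (lookup⇒∈ c∈) (lookup⇒∈ d∈)
        (subst₂ _~_ (sym (dec∘enc c)) (sym (dec∘enc d)) c~d)
    ; meets       = λ c → Sum.map ∈⇒lookup ∈⇒lookup (edge-meets (enc c) _ (mate-toMatching P c))
    }
    where open KEWitness W

  module _ (M : Matching X) (apm : AlmostPerfect M) where

    private
      w : Fin (n X)
      w = proj₁ apm

    liftPairing : Pairing
    liftPairing = record
      { pair            = lifted
      ; pair-adjacent   = adjacent
      ; pair-involutive = involutive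
      }
      where
      lifted : V → V
      lifted (inj₁ v)       = inj₂ (v , w)
      lifted (inj₂ (v , a)) = over v (mate M a)
      adjacent : ∀ c → c ~ lifted c
      adjacent (inj₁ v)       = hub~copy v w
      adjacent (inj₂ (v , a)) with mate M a in eq
      ... | nothing = copy~hub v a
      ... | just b  = copy~copy (mate-adj M a b eq)
      involutive : ∀ c → lifted (lifted c) ≡ c
      involutive (inj₁ v)       = cong (over v) (proj₁ (proj₂ apm))
      involutive (inj₂ (v , a)) with mate M a in eq
      ... | nothing = cong (λ b → inj₂ (v , b)) (sym (AlmostPerfect-exposed-unique M apm eq))
      ... | just b  = cong (over v) (mate-symm M a b eq)

    copiesOf : Subset (n X) → V → Bool
    copiesOf S (inj₁ _)       = false
    copiesOf S (inj₂ (_ , a)) = lookup S a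

    liftTransversal : ∀ {S} → KEWitness X S M → IndependentTransversal liftPairing (copiesOf S)
    liftTransversal {S} W = record { independent = independentᶜ ; meets = meets }
      where
      open KEWitness W
      independentᶜ : ∀ c d → copiesOf S c ≡ true → copiesOf S d ≡ true → c ~ d → ⊥
      independentᶜ (inj₂ (_ , a)) (inj₂ (_ , b)) a∈ b∈ c~d =
        independent a b (lookup⇒∈ a∈) (lookup⇒∈ b∈) (copy~copy⁻ c~d)
      meets : ∀ c → copiesOf S c ≡ true ⊎ copiesOf S (pair liftPairing c) ≡ true
      meets (inj₁ v)       = inj₂ (∈⇒lookup (exposed∈ w (proj₁ (proj₂ apm))))
      meets (inj₂ (v , a)) with mate M a in eq
      ... | nothing = inj₁ (∈⇒lookup (exposed∈ a eq))
      ... | just b  = Sum.map ∈⇒lookup ∈⇒lookup (edge-meets a b eq)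

  module _ (P : Pairing) where

    pair-copy≡over : ∀ {v a m} → position (pair P (inj₂ (v , a))) ≡ m → pair P (inj₂ (v , a)) ≡ over v m
    pair-copy≡over {v} {a} e = trans (copy-neighbour _ (pair-adjacent P (inj₂ (v , a)))) (cong (over v) e)

    pair-over : ∀ {v a m} → position (pair P (inj₂ (v , a))) ≡ m → pair P (over v m) ≡ inj₂ (v , a)
    pair-over e = trans (cong (pair P) (sym (pair-copy≡over e))) (pair-involutive P _)

    restrict : Fin (n H) → Matching X
    restrict v = record
      { mate      = λ a → position (pair P (inj₂ (v , a)))
      ; mate-adj  = λ a b e →
          copy~copy⁻ (subst (inj₂ (v , a) ~_) (pair-copy≡over e) (pair-adjacent P (inj₂ (v , a))))
      ; mate-symm = λ a b e → cong position (pair-over e)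
      }

    module _ {s : V → Bool} (T : IndependentTransversal P s) (a₀ : Fin (n X)) where

      open IndependentTransversal T

      hub∈⇒copy∉ : ∀ {v a} → s (inj₁ v) ≡ true → s (inj₂ (v , a)) ≡ true → ⊥
      hub∈⇒copy∉ {v} {a} v∈ a∈ = independent (inj₁ v) (inj₂ (v , a)) v∈ a∈ (hub~copy v a)

      -- The partner of (v , a₀) is v itself or lies in v's copy, and an end of that edge is in s.
      hub∈⇒¬pair-hub : ∀ {v u} → s (inj₁ v) ≡ true → pair P (inj₁ v) ≢ inj₁ u
      hub∈⇒¬pair-hub {v} v∈ eq with position (pair P (inj₂ (v , a₀))) in e
      ... | nothing with trans (sym eq) (pair-over e)
      ...   | ()
      hub∈⇒¬pair-hub {v} v∈ eq | just c =
        Sum.[ hub∈⇒copy∉ v∈ , hub∈⇒copy∉ v∈ ∘ subst (λ d → s d ≡ true) (pair-copy≡over e) ]′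
          (meets (inj₂ (v , a₀)))

      hub-paired-in-copy : ∀ v → Σ (Fin (n X)) λ a → pair P (inj₁ v) ≡ inj₂ (v , a)
      hub-paired-in-copy v with pair P (inj₁ v) in eq
      ... | inj₂ (u , a) = a , cong (λ x → inj₂ (x , a))
            (sym (hub~copy⁻ {a = a} (subst (inj₁ v ~_) eq (pair-adjacent P (inj₁ v)))))
      ... | inj₁ u = ⊥-elim (Sum.[ (λ v∈ → hub∈⇒¬pair-hub v∈ eq) , (λ u∈ → hub∈⇒¬pair-hub
              (subst (λ d → s d ≡ true) eq u∈) (trans (cong (pair P) (sym eq)) (pair-involutive P _))) ]′
            (meets (inj₁ v)))

      exposedAt : Fin (n H) → Fin (n X)
      exposedAt v = proj₁ (hub-paired-in-copy v)

      restrict-exposed-unique : ∀ {v b} → mate (restrict v) b ≡ nothing → b ≡ exposedAt v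
      restrict-exposed-unique {v} e =
        just-injective (cong position (trans (sym (pair-over e)) (proj₂ (hub-paired-in-copy v))))

      restrict-almostPerfect : ∀ v → AlmostPerfect (restrict v)
      restrict-almostPerfect v = exposedAt v , exposedAt-exposed , saturated
        where
        exposedAt-exposed : mate (restrict v) (exposedAt v) ≡ nothing
        exposedAt-exposed = cong position
          (trans (cong (pair P) (sym (proj₂ (hub-paired-in-copy v)))) (pair-involutive P _))
        saturated : ∀ b → b ≢ exposedAt v → Saturated (restrict v) b
        saturated b b≢a with position (pair P (inj₂ (v , b))) in e
        ... | just c  = c , refl
        ... | nothing = contradiction (restrict-exposed-unique e) b≢a

      -- This is the trace of s on v's copy when v ∉ s, and just {exposedAt v} when v ∈ s.
      coverAt : Fin (n H) → Subset (n X)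
      coverAt v = ⁅ exposedAt v ⁆ ∪ Vec.tabulate (λ b → s (inj₂ (v , b)))

      restrictWitness : ∀ v → KEWitness X (coverAt v) (restrict v)
      restrictWitness v = record
        { independent = independentˣ
        ; exposed∈    = λ b e →
            x∈p∪q⁺ (inj₁ (subst (_∈ ⁅ a ⁆) (sym (restrict-exposed-unique e)) (x∈⁅x⁆ a)))
        ; edge-meets  = λ b c e → Sum.map inCover (inCover ∘ subst (λ d → s d ≡ true) (pair-copy≡over e))
                                    (meets (inj₂ (v , b)))
        }
        where
        a : Fin (n X)
        a = exposedAt v
        inCover : ∀ {b} → s (inj₂ (v , b)) ≡ true → b ∈ coverAt v
        inCover = x∈p∪q⁺ ∘ inj₂ ∘ ∈-tabulate⁺
        members : ∀ {b} → b ∈ coverAt v → b ≡ a ⊎ s (inj₂ (v , b)) ≡ true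
        members b∈ = Sum.map (x∈⁅y⁆⇒x≡y a) ∈-tabulate⁻ (x∈p∪q⁻ ⁅ a ⁆ _ b∈)
        independentˣ : Independent X (coverAt v)
        independentˣ b c b∈ c∈ bc with meets (inj₁ v)
        ... | inj₁ v∈ = Adj⇒≢ X bc (trans (only-a b∈) (sym (only-a c∈)))
          where
          only-a : ∀ {x} → x ∈ coverAt v → x ≡ a
          only-a x∈ = Sum.[ id , ⊥-elim ∘ hub∈⇒copy∉ v∈ ]′ (members x∈)
        ... | inj₂ a∈ = independent _ _ (in-copy b∈) (in-copy c∈) (copy~copy bc)
          where
          in-copy : ∀ {x} → x ∈ coverAt v → s (inj₂ (v , x)) ≡ true
          in-copy x∈ = Sum.[ (λ x≡a → subst (λ y → s (inj₂ (v , y)) ≡ true) (sym x≡a)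
                                        (subst (λ d → s d ≡ true) (proj₂ (hub-paired-in-copy v)) a∈)) , id ]′
                             (members x∈)

      pair≗liftPairing : ∀ M apm → (∀ v → SameMatching M (restrict v)) →
                         ∀ c → pair P c ≡ pair (liftPairing M apm) c
      pair≗liftPairing M apm M≈ (inj₁ v) = trans (proj₂ (hub-paired-in-copy v))
        (cong (λ a → inj₂ (v , a)) (AlmostPerfect-exposed-unique M apm
          (trans (M≈ v (exposedAt v)) (proj₁ (proj₂ (restrict-almostPerfect v))))))
      pair≗liftPairing M apm M≈ (inj₂ (v , b)) = pair-copy≡over (sym (M≈ v b))

  liftPairing-injective : Fin (n H) → ∀ {N apm N′ apm′} →
    SameMatching (toMatching (liftPairing N apm)) (toMatching (liftPairing N′ apm′)) → SameMatching N N′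
  liftPairing-injective v {N} {apm} {N′} {apm′} L≈L′ b = begin
    mate N b                      ≡⟨ position-over v (mate N b) ⟨
    position (over v (mate N b))  ≡⟨ cong position (L≗L′ (inj₂ (v , b))) ⟩
    position (over v (mate N′ b)) ≡⟨ position-over v (mate N′ b) ⟩
    mate N′ b                     ∎
    where
    open ≡-Reasoning
    L≗L′ : ∀ c → pair (liftPairing N apm) c ≡ pair (liftPairing N′ apm′) c
    L≗L′ = SameMatching⇒pair≗ {liftPairing N apm} {liftPairing N′ apm′} L≈L′

  KE-lift : KE X → (M : Matching X) (apm : AlmostPerfect M) → KE C
  KE-lift ke M apm = KEWitness⇒KE (IndependentTransversal⇒KEWitness (liftTransversal M apm
    (proj₂ (KE⇒KEWitness {M = M} ke (AlmostPerfect⇒IsMaximum M apm)))))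

  transversalOf : KE C → (Q : Matching C) (perfect : Perfect Q) →
                  Σ (V → Bool) (IndependentTransversal (pairingOf Q perfect))
  transversalOf ke Q perfect = _ , KEWitness⇒IndependentTransversal
    (KEWitness-resp (sym ∘ toMatching-pairingOf Q perfect)
      (proj₂ (KE⇒KEWitness {M = Q} ke (Perfect⇒IsMaximum Q perfect))))

  KE×almostPerfect⇒KE×perfect : KE X × HasAlmostPerfectMatching X → KE C × HasPerfectMatching C
  KE×almostPerfect⇒KE×perfect (ke , M , apm) =
    KE-lift ke M apm , toMatching (liftPairing M apm) , toMatching-perfect (liftPairing M apm)

  KE×perfect⇒KE×almostPerfect : Fin (n H) → Fin (n X) →
                                KE C × HasPerfectMatching C → KE X × HasAlmostPerfectMatching X
  KE×perfect⇒KE×almostPerfect v a₀ (ke , Q , perfect) =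
    KEWitness⇒KE (restrictWitness P T a₀ v) , restrict P v , restrict-almostPerfect P T a₀ v
    where
    P : Pairing
    P = pairingOf Q perfect
    T : IndependentTransversal P (proj₁ (transversalOf ke Q perfect))
    T = proj₂ (transversalOf ke Q perfect)

  KE×uniqueAlmostPerfect⇒KE×uniquePerfect :
    KE X × HasUniqueAlmostPerfectMatching X → KE C × HasUniquePerfectMatching C
  KE×uniqueAlmostPerfect⇒KE×uniquePerfect (ke , M , apm , unique) =
    KE-lift ke M apm , toMatching L , toMatching-perfect L , uniqueness
    where
    L : Pairing
    L = liftPairing M apm
    uniqueness : ∀ Q → Perfect Q → SameMatching (toMatching L) Q
    uniqueness Q perfect i =
      trans (pair≗⇒SameMatching {L} {P} (sym ∘ P≗L) i) (toMatching-pairingOf Q perfect i)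
      where
      P : Pairing
      P = pairingOf Q perfect
      T : IndependentTransversal P (proj₁ (transversalOf (KE-lift ke M apm) Q perfect))
      T = proj₂ (transversalOf (KE-lift ke M apm) Q perfect)
      P≗L : ∀ c → pair P c ≡ pair L c
      P≗L = pair≗liftPairing P T (proj₁ apm) M apm
              (λ v → unique (restrict P v) (restrict-almostPerfect P T (proj₁ apm) v))

  uniquePerfect⇒almostPerfect-unique : Fin (n H) → HasUniquePerfectMatching C →
    ∀ N apm N′ apm′ → SameMatching {X} N N′
  uniquePerfect⇒almostPerfect-unique v (_ , _ , unique) N apm N′ apm′ = liftPairing-injective v λ i →
    trans (sym (unique (toMatching (liftPairing N apm)) (toMatching-perfect (liftPairing N apm)) i))
          (unique (toMatching (liftPairing N′ apm′)) (toMatching-perfect (liftPairing N′ apm′)) i)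

  KE×uniquePerfect⇒KE×uniqueAlmostPerfect : Fin (n H) → Fin (n X) →
    KE C × HasUniquePerfectMatching C → KE X × HasUniqueAlmostPerfectMatching X
  KE×uniquePerfect⇒KE×uniqueAlmostPerfect v a₀ (ke , Q , perfect , unique) =
    let keX , N , apm = KE×perfect⇒KE×almostPerfect v a₀ (ke , Q , perfect)
    in  keX , N , apm , uniquePerfect⇒almostPerfect-unique v (Q , perfect , unique) N apm

corollary2p7 : (H X : Graph) → n H ≥ 1 → n X ≥ 1 →
    ((KE (H ∘ᶜ X) × HasPerfectMatching (H ∘ᶜ X)) ⇔ (KE X × HasAlmostPerfectMatching X))
    × ((KE (H ∘ᶜ X) × HasUniquePerfectMatching (H ∘ᶜ X)) ⇔ (KE X × HasUniqueAlmostPerfectMatching X))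
corollary2p7 H X hH hX =
  mk⇔ (KE×perfect⇒KE×almostPerfect v a₀) KE×almostPerfect⇒KE×perfect ,
  mk⇔ (KE×uniquePerfect⇒KE×uniqueAlmostPerfect v a₀) KE×uniqueAlmostPerfect⇒KE×uniquePerfect
  where
  open Corona H X
  v : Fin (n H)
  v = fromℕ< hH
  a₀ : Fin (n X)
  a₀ = fromℕ< hX
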